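{- Let $n\ge 5$ and let $B$ be the real $n\times n$ matrix $$B=\begin{bmatrix} a_1&1&1&\cdots&1\\ a_2&0&&&\\ a_3&&-b_1&&\\ \vdots&&&\ddots&\\ a_n&&&&-b_{n-2}\end{bmatrix}$$ (all unspecified entries zero), where $b_j>0$ for $j=1,\dots,n-3$, the real numbers $a_1,\dots,a_n,b_{n-2}$ are such that $B\in Q(\mathcal{A}_i)$ for some $i\in\{1,2,3\}$, and $b_1>b_2>\cdots>b_{n-2}$. Then $-b_j$ is not an eigenvalue of $B$ for any $j\in\{1,\dots,n-2\}$.
   Context: For an $n\times n$ sign pattern $\mathcal{A}$ (matrix with entries in $\{+,-,0\}$), $Q(\mathcal{A})$ is the set of real matrices whose entrywise signs equal $\mathcal{A}$. The $n\times n$ sign patterns are: in all three, every off-diagonal entry not in the first row or first column is $0$, and the $(2,2)$ entry is $0$. $\mathcal{A}_1$: $(1,1)$ entry $+$, entries $(1,j)$, $j\ge2$, are $+$, entries $(j,1)$, $j\ge 2$, are $-$, diagonal entries $(j,j)$, $3\le j\le n$, are $-$. $\mathcal{A}_2$: $(1,1)$ entry $-$, entries $(1,j)$, $j\ge 2$, are $+$, $(2,1)$ entry $-$, entries $(j,1)$, $3\le j\le n$, are $+$, diagonal entries $(j,j)$, $3\le j\le n$, are $-$. $\mathcal{A}_3$: $(1,1)$ entry $-$, entries $(1,j)$, $j\ge2$, are $+$, entries $(j,1)$, $2\le j\le n-1$, are $+$, $(n,1)$ entry $-$, diagonal entries $(j,j)$, $3\le j\le n-1$, are $-$, and $(n,n)$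 entry $+$. -}

module Defs where

open import Level using (Level; _⊔_) renaming (suc to lsuc)
open import Data.Nat using (ℕ; zero; suc)
open import Data.Fin using (Fin; zero; suc; fromℕ; _≟_)
open import Data.Product using (∃; _×_)
open import Data.Bool using (if_then_else_)
open import Relation.Nullary using (¬_; does)
open import Relation.Binary using (Rel; IsStrictTotalOrder)
open import Algebra.Bundles using (CommutativeRing)

-- An ordered field: a commutative ring which is a field, with a strict
-- total order compatible with addition and multiplication.
-- (The reals are the intended instance.)
record OrderedField c ℓ₁ ℓ₂ : Set (lsuc (c ⊔ ℓ₁ ⊔ ℓ₂)) where
  field
    commutativeRing : CommutativeRing c ℓ₁
  open CommutativeRing commutativeRing public
  field
    _<_                : Rel Carrier ℓ₂
    isStrictTotalOrder : IsStrictTotalOrder _≈_ _<_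
    0≉1                : ¬ (0# ≈ 1#)
    inverse            : ∀ x → ¬ (x ≈ 0#) → ∃ λ y → (x * y) ≈ 1#
    +-mono-<           : ∀ {x y} z → x < y → (x + z) < (y + z)
    *-pos              : ∀ {x y} → 0# < x → 0# < y → 0# < (x * y)

data Sign : Set where
  plus minus zer : Sign

-- Sign patterns and real-style matrices are indexed by Fin n (0-based).
SignPattern : ℕ → Set
SignPattern n = Fin n → Fin n → Sign

-- The three sign patterns of the paper, for n = 2 + m.
-- Index 0 is the paper's row/column 1, index 1 the paper's row/column 2,
-- index (2 + k) the paper's row/column k+3.
𝒜₁ : (m : ℕ) → SignPattern (suc (suc m))
𝒜₁ m zero zero = plus
𝒜₁ m zero (suc j) = plus
𝒜₁ m (suc i) zero = minus
𝒜₁ m (suc zero) (suc _) = zer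
𝒜₁ m (suc (suc i)) (suc zero) = zer
𝒜₁ m (suc (suc i)) (suc (suc j)) = if does (i ≟ j) then minus else zer

𝒜₂ : (m : ℕ) → SignPattern (suc (suc m))
𝒜₂ m zero zero = minus
𝒜₂ m zero (suc j) = plus
𝒜₂ m (suc zero) zero = minus
𝒜₂ m (suc (suc i)) zero = plus
𝒜₂ m (suc zero) (suc _) = zer
𝒜₂ m (suc (suc i)) (suc zero) = zer
𝒜₂ m (suc (suc i)) (suc (suc j)) = if does (i ≟ j) then minus else zer

-- In 𝒜₃ the last index (paper's n) is fromℕ (suc m) : Fin (2 + m).
𝒜₃ : (m : ℕ) → SignPattern (suc (suc m))
𝒜₃ m zero zero = minus
𝒜₃ m zero (suc j) = plus
𝒜₃ m (suc i) zero = if does (suc i ≟ fromℕ (suc m)) then minus else plus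
𝒜₃ m (suc zero) (suc _) = zer
𝒜₃ m (suc (suc i)) (suc zero) = zer
𝒜₃ m (suc (suc i)) (suc (suc j)) =
  if does (i ≟ j)
  then (if does (suc (suc i) ≟ fromℕ (suc m)) then plus else minus)
  else zer

module _ {c ℓ₁ ℓ₂} (F : OrderedField c ℓ₁ ℓ₂) where
  open OrderedField F using (Carrier; _≈_; _<_; 0#; 1#; _+_; _*_; -_)

  HasSign : Sign → Carrier → Set (ℓ₁ ⊔ ℓ₂)
  HasSign plus  x = Level.Lift (ℓ₁ ⊔ ℓ₂) (0# < x)
  HasSign minus x = Level.Lift (ℓ₁ ⊔ ℓ₂) (x < 0#)
  HasSign zer   x = Level.Lift (ℓ₁ ⊔ ℓ₂) (x ≈ 0#)

  Matrix : ℕ → Set c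
  Matrix n = Fin n → Fin n → Carrier

  InQ : ∀ {n} → SignPattern n → Matrix n → Set (ℓ₁ ⊔ ℓ₂)
  InQ {n} P M = ∀ (i j : Fin n) → HasSign (P i j) (M i j)

  ∑ : ∀ {n} → (Fin n → Carrier) → Carrier
  ∑ {zero}  f = 0#
  ∑ {suc n} f = f zero + ∑ (λ i → f (suc i))

  IsEigenvalue : ∀ {n} → Matrix n → Carrier → Set (c ⊔ ℓ₁)
  IsEigenvalue {n} M λ′ =
    ∃ λ (v : Fin n → Carrier) →
      (¬ (∀ i → v i ≈ 0#)) × (∀ i → ∑ (λ j → M i j * v j) ≈ (λ′ * v i))

  -- The matrix B of the lemma, n = 2 + m, with a : Fin (2+m) (paper's a_1..a_n)
  -- and b : Fin m (paper's b_1..b_{n-2}).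
  Bmat : ∀ m → (Fin (suc (suc m)) → Carrier) → (Fin m → Carrier) → Matrix (suc (suc m))
  Bmat m a b zero zero = a zero
  Bmat m a b zero (suc j) = 1#
  Bmat m a b (suc i) zero = a (suc i)
  Bmat m a b (suc zero) (suc _) = 0#
  Bmat m a b (suc (suc i)) (suc zero) = 0#
  Bmat m a b (suc (suc i)) (suc (suc j)) = if does (i ≟ j) then - b i else 0#

module Submission where

-- Index rows and vector components from 0, as the code does.  Suppose
-- B v = −b_j v.  Row j+2 reads a_{j+2} v₀ − b_j v_{j+2} = −b_j v_{j+2}, so
-- a_{j+2} v₀ = 0 and v₀ = 0 since a_{j+2} ≠ 0.  Row i+2, i ≠ j, then reads
-- −b_i v_{i+2} = −b_j v_{i+2}, hence v_{i+2} = 0 because the b's are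
-- distinct.  Row 1 reads a₁ v₀ = −b_j v₁, so v₁ = 0 as −b_j ≠ 0.  Finally
-- row 0 reads a₀ v₀ + v₁ + ∑ₖ v_{k+2} = −b_j v₀ = 0, leaving v_{j+2} = 0;
-- so v = 0, contradicting v being an eigenvector.
--
-- The theorem follows by
-- splitting on the pattern.

open import Defs
open import Data.Nat using (ℕ; _≤_; _<_; suc)
open import Data.Fin using (Fin; toℕ; zero; suc; fromℕ; _≟_) renaming (_<_ to _<ᶠ_)
open import Data.Fin.Properties using (<-cmp; suc-injective)
open import Level using (lift)
open import Data.Sum using (_⊎_; inj₁; inj₂)
open import Data.Product using (_,_)
open import Data.Bool using (true; false)
open import Function using (_∘_)
open import Relation.Nullary using (¬_; does; yes; no)
open import Relation.Nullary.Decidable using (dec-true; dec-false)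
open import Relation.Binary using (IsStrictTotalOrder; tri<; tri≈; tri>)
open import Relation.Binary.PropositionalEquality using (_≡_; _≢_; refl; ≢-sym)
import Algebra.Properties.Group as GroupProperties
import Algebra.Properties.Ring as RingProperties
import Relation.Binary.Reasoning.Setoid as SetoidReasoning

-- The only feature of the sign patterns the proof uses: the entries (i+2, 0)
-- (first column) and (i+2, i+2) (diagonal) below the top 2×2 block are
-- prescribed nonzero.
record LowerEntriesNonzero {m} (P : SignPattern (suc (suc m))) : Set where
  field
    column   : ∀ i → P (suc (suc i)) zero ≢ zer
    diagonal : ∀ i → P (suc (suc i)) (suc (suc i)) ≢ zer

𝒜₁-lower-nonzero : ∀ m → LowerEntriesNonzero (𝒜₁ m)
𝒜₁-lower-nonzero m = record { column = λ _ (); diagonal = diagonal }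
  where
  diagonal : ∀ i → 𝒜₁ m (suc (suc i)) (suc (suc i)) ≢ zer
  diagonal i rewrite dec-true (i ≟ i) refl = λ ()

𝒜₂-lower-nonzero : ∀ m → LowerEntriesNonzero (𝒜₂ m)
𝒜₂-lower-nonzero m = record { column = λ _ (); diagonal = diagonal }
  where
  diagonal : ∀ i → 𝒜₂ m (suc (suc i)) (suc (suc i)) ≢ zer
  diagonal i rewrite dec-true (i ≟ i) refl = λ ()

𝒜₃-lower-nonzero : ∀ m → LowerEntriesNonzero (𝒜₃ m)
𝒜₃-lower-nonzero m = record { column = column; diagonal = diagonal }
  where
  column : ∀ i → 𝒜₃ m (suc (suc i)) zero ≢ zer
  column i with does (suc (suc i) ≟ fromℕ (suc m))
  ... | true  = λ ()
  ... | false = λ ()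

  diagonal : ∀ i → 𝒜₃ m (suc (suc i)) (suc (suc i)) ≢ zer
  diagonal i rewrite dec-true (i ≟ i) refl with does (suc (suc i) ≟ fromℕ (suc m))
  ... | true  = λ ()
  ... | false = λ ()

module _ {c ℓ₁ ℓ₂} (F : OrderedField c ℓ₁ ℓ₂) where
  open OrderedField F
    hiding (zero)
    renaming (_<_ to _<ₒ_; refl to ≈-refl; sym to ≈-sym; trans to ≈-trans; reflexive to ≈-reflexive)
  open GroupProperties +-group using (identityˡ-unique; ⁻¹-injective; x∙y⁻¹≈ε⇒x≈y; x≈y⇒x∙y⁻¹≈ε)
  open RingProperties ring using ([y-z]x≈yx-zx)
  open IsStrictTotalOrder isStrictTotalOrder using (irrefl)
  open SetoidReasoning setoid

  sign-nonzero : ∀ {s x} → s ≢ zer → HasSign F s x → ¬ (x ≈ 0#)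
  sign-nonzero {plus}  _     (lift 0<x) x≈0 = irrefl (≈-sym x≈0) 0<x
  sign-nonzero {minus} _     (lift x<0) x≈0 = irrefl x≈0 x<0
  sign-nonzero {zer}   s≢zer _          _   = s≢zer refl

  nonzero-cancel : ∀ {x y} → ¬ (x ≈ 0#) → x * y ≈ 0# → y ≈ 0#
  nonzero-cancel {x} {y} x≉0 xy≈0 with inverse x x≉0
  ... | x⁻¹ , xx⁻¹≈1 = begin
    y              ≈⟨ *-identityˡ y ⟨
    1# * y         ≈⟨ *-congʳ (≈-trans (≈-sym xx⁻¹≈1) (*-comm x x⁻¹)) ⟩
    (x⁻¹ * x) * y  ≈⟨ *-assoc x⁻¹ x y ⟩
    x⁻¹ * (x * y)  ≈⟨ *-congˡ xy≈0 ⟩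
    x⁻¹ * 0#       ≈⟨ zeroʳ x⁻¹ ⟩
    0#             ∎

  distinct-scalars : ∀ {x y v} → ¬ (x ≈ y) → x * v ≈ y * v → v ≈ 0#
  distinct-scalars {x} {y} {v} x≉y xv≈yv =
    nonzero-cancel (x≉y ∘ x∙y⁻¹≈ε⇒x≈y x y)
      (≈-trans ([y-z]x≈yx-zx v x y) (x≈y⇒x∙y⁻¹≈ε xv≈yv))

  *-vanishes : ∀ x {v} → v ≈ 0# → x * v ≈ 0#
  *-vanishes x v≈0 = ≈-trans (*-congˡ v≈0) (zeroʳ x)

  decreasing⇒distinct : ∀ {m} (b : Fin m → Carrier) →
    (∀ i j → i <ᶠ j → b j <ₒ b i) → ∀ i j → i ≢ j → ¬ (b i ≈ b j)
  decreasing⇒distinct b decreasing i j i≢j bi≈bj with <-cmp i j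
  ... | tri< i<j _ _ = irrefl (≈-sym bi≈bj) (decreasing i j i<j)
  ... | tri≈ _ i≡j _ = i≢j i≡j
  ... | tri> _ _ j<i = irrefl bi≈bj (decreasing j i j<i)

  ∑-cong : ∀ {n} {f g : Fin n → Carrier} → (∀ k → f k ≈ g k) → ∑ F f ≈ ∑ F g
  ∑-cong {0}     f≈g = ≈-refl
  ∑-cong {suc n} f≈g = +-cong (f≈g zero) (∑-cong (f≈g ∘ suc))

  ∑-zero : ∀ {n} (f : Fin n → Carrier) → (∀ k → f k ≈ 0#) → ∑ F f ≈ 0#
  ∑-zero {n} f f≈0 = ≈-trans (∑-cong f≈0) (∑-0 n)
    where
    ∑-0 : ∀ n → ∑ F {n} (λ _ → 0#) ≈ 0#
    ∑-0 0       = ≈-refl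
    ∑-0 (suc n) = ≈-trans (+-identityˡ _) (∑-0 n)

  ∑-single : ∀ {n} (f : Fin n → Carrier) (j : Fin n) →
    (∀ k → k ≢ j → f k ≈ 0#) → ∑ F f ≈ f j
  ∑-single f zero    off =
    ≈-trans (+-congˡ (∑-zero (f ∘ suc) (λ k → off (suc k) (λ ())))) (+-identityʳ (f zero))
  ∑-single f (suc j) off =
    ≈-trans (+-cong (off zero (λ ())) (∑-single (f ∘ suc) j (λ k k≢j → off (suc k) (k≢j ∘ suc-injective))))
            (+-identityˡ (f (suc j)))

  module _ (m : ℕ) (a : Fin (suc (suc m)) → Carrier) (b : Fin m → Carrier) where
    private
      B : Matrix F (suc (suc m))
      B = Bmat F m a b

    B-diagonal : ∀ i → B (suc (suc i)) (suc (suc i)) ≡ - b i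
    B-diagonal i rewrite dec-true (i ≟ i) refl = refl

    B-off-diagonal : ∀ i k → i ≢ k → B (suc (suc i)) (suc (suc k)) ≡ 0#
    B-off-diagonal i k i≢k rewrite dec-false (i ≟ k) i≢k = refl

    row-first : ∀ (v : Fin (suc (suc m)) → Carrier) →
      ∑ F (λ k → B zero k * v k) ≈ a zero * v zero + (v (suc zero) + ∑ F (λ k → v (suc (suc k))))
    row-first v = +-congˡ (+-cong (*-identityˡ _) (∑-cong {m} (λ k → *-identityˡ (v (suc (suc k))))))

    row-second : ∀ (v : Fin (suc (suc m)) → Carrier) →
      ∑ F (λ k → B (suc zero) k * v k) ≈ a (suc zero) * v zero
    row-second v =
      ≈-trans (+-congˡ (∑-zero (λ k → 0# * v (suc k)) (λ k → zeroˡ _))) (+-identityʳ _)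

    row-lower : ∀ (v : Fin (suc (suc m)) → Carrier) i →
      ∑ F (λ k → B (suc (suc i)) k * v k) ≈ a (suc (suc i)) * v zero + - b i * v (suc (suc i))
    row-lower v i = +-congˡ (begin
      0# * v (suc zero) + ∑ F (λ k → B (suc (suc i)) (suc (suc k)) * v (suc (suc k)))
        ≈⟨ ≈-trans (+-congʳ (zeroˡ _)) (+-identityˡ _) ⟩
      ∑ F (λ k → B (suc (suc i)) (suc (suc k)) * v (suc (suc k)))
        ≈⟨ ∑-single _ i off-diagonal ⟩
      B (suc (suc i)) (suc (suc i)) * v (suc (suc i))
        ≈⟨ *-congʳ (≈-reflexive (B-diagonal i)) ⟩
      - b i * v (suc (suc i)) ∎)
      where
      off-diagonal : ∀ k → k ≢ i → B (suc (suc i)) (suc (suc k)) * v (suc (suc k)) ≈ 0#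
      off-diagonal k k≢i =
        ≈-trans (*-congʳ (≈-reflexive (B-off-diagonal i k (≢-sym k≢i)))) (zeroˡ _)

    not-eigenvalue : ∀ j → ¬ (a (suc (suc j)) ≈ 0#) → ¬ (- b j ≈ 0#) →
      (∀ i → i ≢ j → ¬ (b i ≈ b j)) → ¬ IsEigenvalue F B (- b j)
    not-eigenvalue j aⱼ≉0 bⱼ≉0 distinct (v , v≉0 , Bv≈bv) = v≉0 v≈0
      where
      w : Fin m → Carrier
      w k = v (suc (suc k))

      lower : ∀ i → a (suc (suc i)) * v zero + - b i * w i ≈ - b j * w i
      lower i = ≈-trans (≈-sym (row-lower v i)) (Bv≈bv (suc (suc i)))

      -- row j+2 forces a_{j+2} v₀ = 0
      v₀≈0 : v zero ≈ 0#
      v₀≈0 = nonzero-cancel aⱼ≉0 (identityˡ-unique _ _ (lower j))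

      -- with v₀ = 0, row i+2 reads −b_i w_i = −b_j w_i
      w≈0 : ∀ i → i ≢ j → w i ≈ 0#
      w≈0 i i≢j = distinct-scalars (distinct i i≢j ∘ ⁻¹-injective) (begin
        - b i * w i                            ≈⟨ +-identityˡ _ ⟨
        0# + - b i * w i                       ≈⟨ +-congʳ (*-vanishes _ v₀≈0) ⟨
        a (suc (suc i)) * v zero + - b i * w i ≈⟨ lower i ⟩
        - b j * w i                            ∎)

      -- row 1 reads a₁ v₀ = −b_j v₁
      v₁≈0 : v (suc zero) ≈ 0#
      v₁≈0 = nonzero-cancel bⱼ≉0 (begin
        - b j * v (suc zero)             ≈⟨ Bv≈bv (suc zero) ⟨
        ∑ F (λ k → B (suc zero) k * v k) ≈⟨ row-second v ⟩
        a (suc zero) * v zero            ≈⟨ *-vanishes _ v₀≈0 ⟩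
        0#                               ∎)

      -- row 0 reads a₀ v₀ + v₁ + ∑ w = −b_j v₀, and only w_j survives in ∑ w
      wⱼ≈0 : w j ≈ 0#
      wⱼ≈0 = begin
        w j                                      ≈⟨ ∑-single w j w≈0 ⟨
        ∑ F w                                    ≈⟨ ≈-trans (+-identityˡ _) (+-identityˡ _) ⟨
        0# + (0# + ∑ F w)                        ≈⟨ +-cong (*-vanishes _ v₀≈0) (+-congʳ v₁≈0) ⟨
        a zero * v zero + (v (suc zero) + ∑ F w) ≈⟨ row-first v ⟨
        ∑ F (λ k → B zero k * v k)               ≈⟨ Bv≈bv zero ⟩
        - b j * v zero                           ≈⟨ *-vanishes _ v₀≈0 ⟩
        0#                                       ∎

      v≈0 : ∀ i → v i ≈ 0#
      v≈0 zero          = v₀≈0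
      v≈0 (suc zero)    = v₁≈0
      v≈0 (suc (suc i)) with i ≟ j
      ... | yes refl = wⱼ≈0
      ... | no i≢j   = w≈0 i i≢j

    not-eigenvalue-in-pattern : ∀ {P} → LowerEntriesNonzero P → InQ F P B →
      (∀ i j → i <ᶠ j → b j <ₒ b i) → ∀ j → ¬ IsEigenvalue F B (- b j)
    not-eigenvalue-in-pattern P-nonzero B∈Q decreasing j =
      not-eigenvalue j a-nonzero b-nonzero (λ i i≢j → decreasing⇒distinct b decreasing i j i≢j)
      where
      open LowerEntriesNonzero P-nonzero
      a-nonzero : ¬ (a (suc (suc j)) ≈ 0#)
      a-nonzero = sign-nonzero (column j) (B∈Q (suc (suc j)) zero)
      b-nonzero : ¬ (- b j ≈ 0#)
      b-nonzero bⱼ≈0 = sign-nonzero (diagonal j) (B∈Q (suc (suc j)) (suc (suc j)))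
                         (≈-trans (≈-reflexive (B-diagonal j)) bⱼ≈0)

lemma3p4 : ∀ {c ℓ₁ ℓ₂} (F : OrderedField c ℓ₁ ℓ₂) →
    (m : ℕ) → 3 ≤ m →
    (a : Fin (suc (suc m)) → OrderedField.Carrier F) → (b : Fin m → OrderedField.Carrier F) →
    (∀ (k : Fin m) → suc (toℕ k) < m → OrderedField._<_ F (OrderedField.0# F) (b k)) →
    (InQ F (𝒜₁ m) (Bmat F m a b) ⊎ InQ F (𝒜₂ m) (Bmat F m a b) ⊎ InQ F (𝒜₃ m) (Bmat F m a b)) →
    (∀ (i j : Fin m) → i <ᶠ j → OrderedField._<_ F (b j) (b i)) →
    ∀ (j : Fin m) → ¬ IsEigenvalue F (Bmat F m a b) (OrderedField.-_ F (b j))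
lemma3p4 F m _ a b _ (inj₁ B∈Q₁)        = not-eigenvalue-in-pattern F m a b (𝒜₁-lower-nonzero m) B∈Q₁
lemma3p4 F m _ a b _ (inj₂ (inj₁ B∈Q₂)) = not-eigenvalue-in-pattern F m a b (𝒜₂-lower-nonzero m) B∈Q₂
lemma3p4 F m _ a b _ (inj₂ (inj₂ B∈Q₃)) = not-eigenvalue-in-pattern F m a b (𝒜₃-lower-nonzero m) B∈Q₃
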